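{- Let $p$ be a prime with $p\nmid\mathrm{Vol}(\Delta)$ and $p>(n+4)D$. Then: (1) for every integer $k\ge0$, the value of $\mathrm{IHP}(\Delta)$ at $x=\mathsf x_k^\pm$ equals $\min\{h(\mathbb S):\mathbb S\subset\mathbb M(\Delta),\ \#\mathbb S=\mathsf x_k^\pm\}$, and this minimum equals $h(\Delta_k^\pm)$; (2) for every $k\ge0$, every slope of $\mathrm{IHP}(\Delta)$ on the interval $[0,\mathsf x_k^-]$ is strictly less than $k(p-1)$; (3) every slope of $\mathrm{IHP}(\Delta)$ on $[\mathsf x_k^+,\infty)$ is strictly greater than $k(p-1)$; (4) every slope of $\mathrm{IHP}(\Delta)$ on $[\mathsf x_k^-,\mathsf x_k^+]$ equals $k(p-1)$; (5) for every $k\ge1$, the points $(\mathsf x_k^\pm,h(\Delta_k^\pm))$ are vertices of $\mathrm{IHP}(\Delta)$.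
   Context: Fix $n\ge1$ and linearly independent $\mathbf V_1,\dots,\mathbf V_n\in\mathbb Z^n$; $\Delta=\{\sum_iz_i\mathbf V_i:0\le z_i\le1\}$ with Euclidean volume $\mathrm{Vol}(\Delta)$; $\mathbb M(\Delta)=\{\sum_iz_i\mathbf V_i:z_i\ge0\}\cap\mathbb Z^n$; weight $w(\sum_iz_i\mathbf V_i)=\max_iz_i$; $D$ is the smallest positive integer with all coordinates of elements of $\mathbb M(\Delta)$ in $\frac1D\mathbb Z_{\ge0}$. For $k\ge0$: $\Delta_k^+=\{\sum_iz_i\mathbf V_i\in\mathbb Z^n:0\le z_i\le k\}$, $\Delta_k^-=\{\sum_iz_i\mathbf V_i\in\mathbb Z^n:0\le z_i<k\}$, $\mathsf x_k^\pm=\#\Delta_k^\pm$. For finite $\mathbb S\subset\mathbb M(\Delta)$, $h(\mathbb S)=\sum_{Q\in\mathbb S}(\lfloor w(pQ)\rfloor-\lfloor w(Q)\rfloor)$. For $\ell\ge0$ let $\mathbb W_\ell$ be a set of $\ell$ elements of $\mathbb M(\Delta)$ whose weights are the $\ell$ smallest weights (with multiplicity); $\mathrm{IHP}(\Delta)$ is the lower convex hull of $\{(\ell,h(\mathbb W_\ell)):\ell\ge0\}$. -}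

module Defs where

open import Data.Nat as ℕ using (ℕ; zero; suc)
open import Data.Integer as ℤ using (ℤ; +_)
open import Data.Rational as ℚ using (ℚ; _/_; floor)
open import Data.Fin using (Fin; toℕ)
open import Data.Vec as Vec using (Vec; []; _∷_; lookup; removeAt; tabulate; foldr; toList)
open import Data.List as List using (List; length)
open import Data.List.Membership.Propositional using (_∈_; _∉_)
open import Data.List.Relation.Unary.Unique.Propositional using (Unique)
open import Data.List.Relation.Unary.All using (All)
open import Data.Product using (Σ; _×_; ∃)
open import Function.Bundles using (_⇔_)
open import Relation.Binary.PropositionalEquality using (_≡_)

ℤ→ℚ : ℤ → ℚ
ℤ→ℚ m = m / 1

ℕ→ℚ : ℕ → ℚ
ℕ→ℚ m = (+ m) / 1

IsInt : ℚ → Set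
IsInt q = Σ ℤ (λ m → q ≡ ℤ→ℚ m)

ΣℤFin : (n : ℕ) → (Fin n → ℤ) → ℤ
ΣℤFin n f = foldr (λ _ → ℤ) ℤ._+_ (+ 0) (tabulate f)

ΣℚFin : (n : ℕ) → (Fin n → ℚ) → ℚ
ΣℚFin n f = foldr (λ _ → ℚ) ℚ._+_ ℚ.0ℚ (tabulate f)

sumℤ : List ℤ → ℤ
sumℤ = List.foldr ℤ._+_ (+ 0)

-- Determinant (Laplace expansion along the first row).
-- A matrix is given by its rows: M : Vec (Vec ℤ n) n, entry (i,j) = lookup (lookup M i) j.

sgn : ℕ → ℤ
sgn zero = + 1
sgn (suc zero) = ℤ.- (+ 1)
sgn (suc (suc k)) = sgn k

det : (n : ℕ) → Vec (Vec ℤ n) n → ℤ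
det zero [] = + 1
det (suc n) (r ∷ rs) =
  ΣℤFin (suc n) (λ j → sgn (toℕ j) ℤ.* (lookup r j ℤ.* det n (Vec.map (λ row → removeAt row j) rs)))

-- V : Vec (Vec ℤ n) n, where lookup V i is the vector 𝐕_i ∈ ℤⁿ.
-- A point of the real cone spanned by the 𝐕_i is represented by its
-- coordinates z = (z_1,…,z_n) ∈ ℚⁿ with respect to the basis 𝐕_1,…,𝐕_n,
-- i.e. it is the point Σ_i z_i 𝐕_i.

module _ {n : ℕ} (V : Vec (Vec ℤ n) n) where

  combCoord : Vec ℚ n → Fin n → ℚ
  combCoord z j = ΣℚFin n (λ i → lookup z i ℚ.* ℤ→ℚ (lookup (lookup V i) j))

  LinIndep : Set
  LinIndep = (c : Vec ℚ n) → (∀ j → combCoord c j ≡ ℚ.0ℚ) → ∀ i → lookup c i ≡ ℚ.0ℚ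

  Vol : ℕ
  Vol = ℤ.∣ det n V ∣

  InM : Vec ℚ n → Set
  InM z = (∀ i → ℚ.0ℚ ℚ.≤ lookup z i) × (∀ j → IsInt (combCoord z j))

  InΔ⁺ : ℕ → Vec ℚ n → Set
  InΔ⁺ k z = InM z × (∀ i → lookup z i ℚ.≤ ℕ→ℚ k)

  InΔ⁻ : ℕ → Vec ℚ n → Set
  InΔ⁻ k z = InM z × (∀ i → lookup z i ℚ.< ℕ→ℚ k)

  Enumerates : (Vec ℚ n → Set) → List (Vec ℚ n) → Set
  Enumerates P L = Unique L × (∀ z → (z ∈ L) ⇔ P z)

  IsDenom : ℕ → Set
  IsDenom d = (0 ℕ.< d) × (∀ z → InM z → ∀ i → IsInt (ℕ→ℚ d ℚ.* lookup z i))

  IsD : ℕ → Set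
  IsD d = IsDenom d × (∀ d' → IsDenom d' → d ℕ.≤ d')

  IsSubsetM : List (Vec ℚ n) → Set
  IsSubsetM S = Unique S × All InM S

w : {n : ℕ} → Vec ℚ n → ℚ
w z = foldr (λ _ → ℚ) ℚ._⊔_ ℚ.0ℚ z

scale : {n : ℕ} → ℕ → Vec ℚ n → Vec ℚ n
scale p z = Vec.map (λ x → ℕ→ℚ p ℚ.* x) z

hpt : {n : ℕ} → ℕ → Vec ℚ n → ℤ
hpt p z = floor (w (scale p z)) ℤ.- floor (w z)

h : {n : ℕ} → ℕ → List (Vec ℚ n) → ℤ
h p S = sumℤ (List.map (hpt p) S)

module _ {n : ℕ} (V : Vec (Vec ℤ n) n) (p : ℕ) where

  -- S is a valid choice of 𝕎_ℓ: ℓ distinct elements of 𝕄(Δ) whose weights are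
  -- the ℓ smallest ones (every element outside S weighs at least as much as
  -- every element inside S).
  IsW : ℕ → List (Vec ℚ n) → Set
  IsW ℓ S = IsSubsetM V S × (length S ≡ ℓ)
            × (∀ Q Q' → Q ∈ S → InM V Q' → Q' ∉ S → w Q ℚ.≤ w Q')

  HW : ℕ → ℤ → Set
  HW ℓ y = Σ (List (Vec ℚ n)) (λ S → IsW ℓ S × (h p S ≡ y))

  -- y lies (weakly) below every chord of the point set {(ℓ, h(𝕎_ℓ))} above x
  BelowChords : ℕ → ℚ → Set
  BelowChords x y = ∀ a b ya yb → a ℕ.≤ x → x ℕ.≤ b → a ℕ.< b → HW a ya → HW b yb →
    y ℚ.* ℕ→ℚ (b ℕ.∸ a) ℚ.≤ ℤ→ℚ ya ℚ.* ℕ→ℚ (b ℕ.∸ x) ℚ.+ ℤ→ℚ yb ℚ.* ℕ→ℚ (x ℕ.∸ a)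

  -- IHP(Δ)(x) = y : the lower convex hull at abscissa x is the supremum of
  -- such lower bounds (for x ∈ ℕ)
  IHPval : ℕ → ℚ → Set
  IHPval x y = BelowChords x y × (∀ y' → BelowChords x y' → y' ℚ.≤ y)

  -- (x, y) is a vertex of IHP(Δ): it is a point (x, h(𝕎_x)) of the set lying
  -- strictly below every chord joining two points on either side of it.
  IsVertex : ℕ → ℤ → Set
  IsVertex x y = HW x y × (∀ a b ya yb → a ℕ.< x → x ℕ.< b → HW a ya → HW b yb →
    ℤ→ℚ y ℚ.* ℕ→ℚ (b ℕ.∸ a) ℚ.< ℤ→ℚ ya ℚ.* ℕ→ℚ (b ℕ.∸ x) ℚ.+ ℤ→ℚ yb ℚ.* ℕ→ℚ (x ℕ.∸ a))

  -- slope of IHP(Δ) on [m, m+1] (IHP is linear there since its vertices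
  -- have integer abscissae)
  SlopeAt : ℕ → (ℚ → Set) → Set
  SlopeAt m P = ∀ y y' → IHPval m y → IHPval (suc m) y' → P (y' ℚ.- y)

  MinProp : List (Vec ℚ n) → Set
  MinProp L = IHPval (length L) (ℤ→ℚ (h p L))
    × (∀ S → IsSubsetM V S → length S ≡ length L → h p L ℤ.≤ h p S)

-- A lattice point Q of the cone has weight w Q = t / D for some t ∈ ℕ. Writing t = q D + r
-- with r < D, its contribution ⌊p w Q⌋ - ⌊w Q⌋ equals q (p - 1) + ⌊p r / D⌋, and as D < p
-- the second summand is a digit in base p - 1. Hence the contribution is monotone in the
-- weight, and it is below, equal to or above k (p - 1) according as w Q is below, equal to
-- or above k. Monotonicity makes every 𝕎_ℓ minimise h among ℓ-element subsets of 𝕄(Δ)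
-- (exchange a heaviest point of 𝕎_ℓ against a point outside it), so ℓ ↦ h(𝕎_ℓ) is well
-- defined, its increment at ℓ is the contribution of a heaviest point of 𝕎_(ℓ+1), and it is
-- convex. Thus IHP(Δ) interpolates the values h(𝕎_ℓ), the sets Δ_k^± are sets 𝕎_ℓ, and the
-- increments are < k (p - 1) before #Δ_k^-, equal to it up to #Δ_k^+ and > k (p - 1) after.

module Submission where

open import Defs
open import Data.Nat using (ℕ; suc; _≤_; _<_; _*_; _+_; _∸_)
open import Data.Nat.Divisibility using (_∣_)
open import Data.Nat.Primality using (Prime)
open import Data.Integer using (ℤ)
open import Data.Rational as ℚ using (ℚ)
open import Data.Vec using (Vec)
open import Data.List using (List; length)
open import Data.Product using (_×_)
open import Relation.Nullary using (¬_)
open import Relation.Binary.PropositionalEquality using (_≡_)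

open import Data.Empty using (⊥-elim)
open import Data.Fin using (Fin; zero; suc)
open import Data.Integer as ℤ using (+_; -[1+_]; 0ℤ)
import Data.Integer.DivMod as ℤD
import Data.Integer.Properties as ℤP
open import Data.Integer.Solver using (module +-*-Solver)
open import Data.List as List using ([]; _∷_)
import Data.List.Membership.DecPropositional as DecMembership
open import Data.List.Membership.Propositional using (_∈_; _∉_; find)
open import Data.List.Membership.Propositional.Properties using (∈-length)
open import Data.List.Properties using (length-removeAt′)
open import Data.List.Relation.Unary.All as All using (All; []; _∷_; all?)
open import Data.List.Relation.Unary.All.Properties using (─⁺; ¬All⇒Any¬)
open import Data.List.Relation.Unary.AllPairs using ([]; _∷_)
open import Data.List.Relation.Unary.Any using (here; there; _─_; index)
open import Data.List.Relation.Unary.Unique.Propositional using (Unique)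
open import Data.Nat as ℕ using (zero; z≤n; s≤s; NonZero; _≤′_; ≤′-refl; ≤′-step)
open import Data.Nat.Coprimality as Coprime using (Coprime)
open import Data.Nat.Divisibility using (n∣m*n)
open import Data.Nat.DivMod using (_/_; _%_; m≡m%n+[m/n]*n; m%n<n; m*n/n≡m; m*n%n≡0;
  m<n*o⇒m/o<n; m≥n⇒m/n>0; m/n*n≤m; /-monoˡ-≤; +-distrib-/-∣ʳ; 0/n≡0)
import Data.Nat.Properties as ℕP
open import Data.Product using (∃-syntax; _,_; proj₁; proj₂)
open import Data.Rational using (mkℚ; floor; *≤*; *<*)
import Data.Rational.Properties as ℚP
open import Data.Sum using (_⊎_; inj₁; inj₂; [_,_]′)
open import Data.Vec as Vec using ([]; _∷_; lookup)
import Data.Vec.Properties as VecP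
open import Function using (_∘_)
open import Function.Bundles using (Equivalence)
open import Relation.Binary.Bundles using (DecTotalOrder)
open import Relation.Binary.Definitions using (DecidableEquality)
open import Relation.Binary.PropositionalEquality
  using (_≢_; refl; sym; trans; cong; cong₂; subst; subst₂; module ≡-Reasoning)
open import Relation.Nullary using (Dec; yes; no)
open import Relation.Nullary.Decidable using (decidable-stable)

open import Algebra.Properties.AbelianGroup ℤP.+-0-abelianGroup using (xyx⁻¹≈y)
import Algebra.Properties.CommutativeSemigroup ℤP.+-commutativeSemigroup as ℤ-+
import Algebra.Properties.CommutativeSemigroup ℤP.*-commutativeSemigroup as ℤ-*
open import Data.List.Extrema (DecTotalOrder.totalOrder ℚP.≤-decTotalOrder)
  using (argmax; argmax-sel; f[⊥]≤f[argmax]; f[xs]≤f[argmax])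

ℤ→ℚ-mkℚ : ∀ m → ℤ→ℚ m ≡ mkℚ m 0 (Coprime.sym (Coprime.1-coprimeTo ℤ.∣ m ∣))
ℤ→ℚ-mkℚ m = ℚP.↥p/↧p≡p (mkℚ m 0 _)

ℤ→ℚ-+ : ∀ a b → ℤ→ℚ (a ℤ.+ b) ≡ ℤ→ℚ a ℚ.+ ℤ→ℚ b
ℤ→ℚ-+ a b rewrite ℤ→ℚ-mkℚ a | ℤ→ℚ-mkℚ b =
  sym (cong₂ (λ x y → (x ℤ.+ y) ℚ./ 1) (ℤP.*-identityʳ a) (ℤP.*-identityʳ b))

ℤ→ℚ-* : ∀ a b → ℤ→ℚ (a ℤ.* b) ≡ ℤ→ℚ a ℚ.* ℤ→ℚ b
ℤ→ℚ-* a b rewrite ℤ→ℚ-mkℚ a | ℤ→ℚ-mkℚ b = refl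

ℤ→ℚ-neg : ∀ a → ℤ→ℚ (ℤ.- a) ≡ ℚ.- ℤ→ℚ a
ℤ→ℚ-neg a rewrite ℤ→ℚ-mkℚ a | ℤ→ℚ-mkℚ (ℤ.- a) with a
... | + zero   = refl
... | + suc _  = refl
... | -[1+ _ ] = refl

ℤ→ℚ-- : ∀ a b → ℤ→ℚ (a ℤ.- b) ≡ ℤ→ℚ a ℚ.- ℤ→ℚ b
ℤ→ℚ-- a b = trans (ℤ→ℚ-+ a (ℤ.- b)) (cong (ℤ→ℚ a ℚ.+_) (ℤ→ℚ-neg b))

ℤ→ℚ-mono-≤ : ∀ {a b} → a ℤ.≤ b → ℤ→ℚ a ℚ.≤ ℤ→ℚ b
ℤ→ℚ-mono-≤ {a} {b} a≤b rewrite ℤ→ℚ-mkℚ a | ℤ→ℚ-mkℚ b =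
  *≤* (subst₂ ℤ._≤_ (sym (ℤP.*-identityʳ a)) (sym (ℤP.*-identityʳ b)) a≤b)

ℤ→ℚ-cancel-≤ : ∀ {a b} → ℤ→ℚ a ℚ.≤ ℤ→ℚ b → a ℤ.≤ b
ℤ→ℚ-cancel-≤ {a} {b} a≤b rewrite ℤ→ℚ-mkℚ a | ℤ→ℚ-mkℚ b with a≤b
... | *≤* le = subst₂ ℤ._≤_ (ℤP.*-identityʳ a) (ℤP.*-identityʳ b) le

ℤ→ℚ-mono-< : ∀ {a b} → a ℤ.< b → ℤ→ℚ a ℚ.< ℤ→ℚ b
ℤ→ℚ-mono-< {a} {b} a<b rewrite ℤ→ℚ-mkℚ a | ℤ→ℚ-mkℚ b =
  *<* (subst₂ ℤ._<_ (sym (ℤP.*-identityʳ a)) (sym (ℤP.*-identityʳ b)) a<b)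

ℤ→ℚ-cancel-< : ∀ {a b} → ℤ→ℚ a ℚ.< ℤ→ℚ b → a ℤ.< b
ℤ→ℚ-cancel-< {a} {b} a<b rewrite ℤ→ℚ-mkℚ a | ℤ→ℚ-mkℚ b with a<b
... | *<* lt = subst₂ ℤ._<_ (ℤP.*-identityʳ a) (ℤP.*-identityʳ b) lt

ℤ→ℚ-*ℕ : ∀ a m → ℤ→ℚ (a ℤ.* + m) ≡ ℤ→ℚ a ℚ.* ℕ→ℚ m
ℤ→ℚ-*ℕ a m = ℤ→ℚ-* a (+ m)

ℕ→ℚ-* : ∀ m n → ℕ→ℚ (m * n) ≡ ℕ→ℚ m ℚ.* ℕ→ℚ n
ℕ→ℚ-* m n = trans (cong ℤ→ℚ (ℤP.pos-* m n)) (ℤ→ℚ-* (+ m) (+ n))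

ℕ→ℚ-mono-≤ : ∀ {m n} → m ≤ n → ℕ→ℚ m ℚ.≤ ℕ→ℚ n
ℕ→ℚ-mono-≤ m≤n = ℤ→ℚ-mono-≤ (ℤ.+≤+ m≤n)

ℕ→ℚ-mono-< : ∀ {m n} → m < n → ℕ→ℚ m ℚ.< ℕ→ℚ n
ℕ→ℚ-mono-< m<n = ℤ→ℚ-mono-< (ℤ.+<+ m<n)

ℕ→ℚ-cancel-≤ : ∀ {m n} → ℕ→ℚ m ℚ.≤ ℕ→ℚ n → m ≤ n
ℕ→ℚ-cancel-≤ {m} {n} m≤n = ℤP.drop‿+≤+ (ℤ→ℚ-cancel-≤ {+ m} {+ n} m≤n)

ℕ→ℚ-cancel-< : ∀ {m n} → ℕ→ℚ m ℚ.< ℕ→ℚ n → m < n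
ℕ→ℚ-cancel-< {m} {n} m<n = ℤP.drop‿+<+ (ℤ→ℚ-cancel-< {+ m} {+ n} m<n)

0≤ℕ→ℚ : ∀ m → ℚ.0ℚ ℚ.≤ ℕ→ℚ m
0≤ℕ→ℚ m = ℕ→ℚ-mono-≤ {0} {m} z≤n

ℕ→ℚ-nonNeg : ∀ m → ℚ.NonNegative (ℕ→ℚ m)
ℕ→ℚ-nonNeg m = ℚ.nonNegative (0≤ℕ→ℚ m)

ℕ→ℚ-pos : ∀ m .{{_ : NonZero m}} → ℚ.Positive (ℕ→ℚ m)
ℕ→ℚ-pos (suc m) = ℚ.positive (ℤ→ℚ-mono-< {0ℤ} {+ suc m} (ℤ.+<+ (s≤s z≤n)))

floor-≤ : ∀ q → ℤ→ℚ (floor q) ℚ.≤ q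
floor-≤ q@(mkℚ n d _) rewrite ℤ→ℚ-mkℚ (floor q) =
  *≤* (subst (floor q ℤ.* + suc d ℤ.≤_) (sym (ℤP.*-identityʳ n)) (ℤD.[n/d]*d≤n n (+ suc d)))

<-floor+1 : ∀ q → q ℚ.< ℤ→ℚ (ℤ.suc (floor q))
<-floor+1 q@(mkℚ n d _) rewrite ℤ→ℚ-mkℚ (ℤ.suc (floor q)) =
  *<* (subst₂ ℤ._<_ (sym (ℤP.*-identityʳ n)) (cong (ℤ._* + suc d) n/d+1≡) (ℤD.n<s[n/ℕd]*d n (suc d)))
  where
  n/d+1≡ : ℤ.suc (n ℤD./ℕ suc d) ≡ ℤ.suc (floor q)
  n/d+1≡ = cong ℤ.suc (sym (ℤD.div-pos-is-/ℕ n (suc d)))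

floor-unique : ∀ {q m} → ℤ→ℚ m ℚ.≤ q → q ℚ.< ℤ→ℚ (ℤ.suc m) → floor q ≡ m
floor-unique {q} {m} m≤q q<m+1 = ℤP.≤-antisym
  (below (ℚP.≤-<-trans (floor-≤ q) q<m+1))
  (below (ℚP.≤-<-trans m≤q (<-floor+1 q)))
  where
  below : ∀ {i j} → ℤ→ℚ i ℚ.< ℤ→ℚ (ℤ.suc j) → i ℤ.≤ j
  below {i} {j} i<j+1 = subst (i ℤ.≤_) (ℤP.pred-suc j) (ℤP.i<j⇒i≤pred[j] (ℤ→ℚ-cancel-< {i} {ℤ.suc j} i<j+1))

w-ub : ∀ {n} (z : Vec ℚ n) i → lookup z i ℚ.≤ w z
w-ub (x ∷ z) zero    = ℚP.p≤p⊔q x (w z)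
w-ub (x ∷ z) (suc i) = ℚP.≤-trans (w-ub z i) (ℚP.p≤q⊔p x (w z))

w-lub : ∀ {n c} (z : Vec ℚ n) → ℚ.0ℚ ℚ.≤ c → (∀ i → lookup z i ℚ.≤ c) → w z ℚ.≤ c
w-lub []      0≤c _   = 0≤c
w-lub (x ∷ z) 0≤c z≤c = ℚP.⊔-lub (z≤c zero) (w-lub z 0≤c (z≤c ∘ suc))

w≡0⊎coordinate : ∀ {n} (z : Vec ℚ n) → w z ≡ ℚ.0ℚ ⊎ ∃[ i ] w z ≡ lookup z i
w≡0⊎coordinate []      = inj₁ refl
w≡0⊎coordinate (x ∷ z) with ℚP.⊔-sel x (w z) | w≡0⊎coordinate z
... | inj₁ w≡x | _             = inj₂ (zero , w≡x)
... | inj₂ w≡w | inj₁ w≡0      = inj₁ (trans w≡w w≡0)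
... | inj₂ w≡w | inj₂ (i , w≡) = inj₂ (suc i , trans w≡w w≡)

w-lub< : ∀ {n c} (z : Vec ℚ n) → ℚ.0ℚ ℚ.< c → (∀ i → lookup z i ℚ.< c) → w z ℚ.< c
w-lub< {c = c} z 0<c z<c with w≡0⊎coordinate z
... | inj₁ w≡0       = subst (ℚ._< c) (sym w≡0) 0<c
... | inj₂ (i , w≡zᵢ) = subst (ℚ._< c) (sym w≡zᵢ) (z<c i)

w-scale : ∀ {n} p (z : Vec ℚ n) → w (scale p z) ≡ ℕ→ℚ p ℚ.* w z
w-scale p []      = sym (ℚP.*-zeroʳ (ℕ→ℚ p))
w-scale p (x ∷ z) = trans (cong (ℕ→ℚ p ℚ.* x ℚ.⊔_) (w-scale p z))
  (sym (ℚP.*-distribˡ-⊔-nonNeg (ℕ→ℚ p) {{ℕ→ℚ-nonNeg p}} x (w z)))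

module FloorGap (D c : ℕ) {{_ : NonZero D}} (D≤c : D ≤ c) where

  -- For t = q D + r with r < D this is ⌊(1 + c) t / D⌋ - ⌊t / D⌋ (floor-gap); its second
  -- summand is a digit in base c (digit-<), so Φ is ordered like the pair (q, r).
  Φ : ℕ → ℕ
  Φ t = t / D * c + suc c * (t % D) / D

  digit-< : ∀ {r} → r < D → suc c * r / D < c
  digit-< {r} r<D = m<n*o⇒m/o<n (ℕP.+-cancelˡ-< (suc c) _ _ (begin-strict
    suc c + suc c * r ≡⟨ ℕP.*-suc (suc c) r ⟨
    suc c * suc r     ≤⟨ ℕP.*-monoʳ-≤ (suc c) r<D ⟩
    D + c * D         <⟨ ℕP.+-monoˡ-< (c * D) (s≤s D≤c) ⟩
    suc c + c * D     ∎))
    where open ℕP.≤-Reasoning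

  digit-pos : ∀ {r} → 0 < r → 0 < suc c * r / D
  digit-pos {suc r} _ = m≥n⇒m/n>0 (ℕP.≤-trans (ℕP.m≤n⇒m≤1+n D≤c) (ℕP.m≤m*n (suc c) (suc r)))

  lex-< : ∀ {q q' s s'} → s < c → q < q' → q * c + s < q' * c + s'
  lex-< {q} {q'} {s} {s'} s<c q<q' = begin-strict
    q * c + s   <⟨ ℕP.+-monoʳ-< (q * c) s<c ⟩
    q * c + c   ≡⟨ ℕP.+-comm (q * c) c ⟩
    suc q * c   ≤⟨ ℕP.*-monoˡ-≤ c q<q' ⟩
    q' * c      ≤⟨ ℕP.m≤m+n (q' * c) s' ⟩
    q' * c + s' ∎
    where open ℕP.≤-Reasoning

  0<c : 0 < c
  0<c = ℕP.<-≤-trans (ℕ.>-nonZero⁻¹ D) D≤c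

  Φ-mono : ∀ {t t'} → t ≤ t' → Φ t ≤ Φ t'
  Φ-mono {t} {t'} t≤t' with ℕP.m≤n⇒m<n∨m≡n (/-monoˡ-≤ D t≤t')
  ... | inj₁ q<q' = ℕP.<⇒≤ (lex-< (digit-< (m%n<n t D)) q<q')
  ... | inj₂ q≡q' = ℕP.+-mono-≤ (ℕP.≤-reflexive (cong (_* c) q≡q'))
                                 (/-monoˡ-≤ D (ℕP.*-monoʳ-≤ (suc c) r≤r'))
    where
    r≤r' : t % D ≤ t' % D
    r≤r' = ℕP.+-cancelʳ-≤ (t / D * D) _ _ (subst₂ _≤_ (m≡m%n+[m/n]*n t D)
      (trans (m≡m%n+[m/n]*n t' D) (cong (λ q → t' % D + q * D) (sym q≡q'))) t≤t')

  Φ-multiple : ∀ k → Φ (k * D) ≡ k * c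
  Φ-multiple k = begin
    k * D / D * c + suc c * (k * D % D) / D ≡⟨ cong₂ (λ q r → q * c + suc c * r / D) (m*n/n≡m k D) (m*n%n≡0 k D) ⟩
    k * c + suc c * 0 / D                 ≡⟨ cong (λ x → k * c + x / D) (ℕP.*-zeroʳ (suc c)) ⟩
    k * c + 0 / D                         ≡⟨ cong (λ x → k * c + x) (0/n≡0 D) ⟩
    k * c + 0                             ≡⟨ ℕP.+-identityʳ (k * c) ⟩
    k * c                                 ∎
    where open ≡-Reasoning

  Φ-< : ∀ {t k} → t < k * D → Φ t < k * c
  Φ-< {t} {k} t<kD = subst (Φ t <_) (ℕP.+-identityʳ (k * c))
    (lex-< {q' = k} {s' = 0} (digit-< (m%n<n t D)) (m<n*o⇒m/o<n t<kD))

  Φ-> : ∀ {t k} → k * D < t → k * c < Φ t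
  Φ-> {t} {k} kD<t with ℕP.m≤n⇒m<n∨m≡n k≤q
    where k≤q = subst (_≤ t / D) (m*n/n≡m k D) (/-monoˡ-≤ D (ℕP.<⇒≤ kD<t))
  ... | inj₁ k<q = subst (_< Φ t) (ℕP.+-identityʳ (k * c)) (lex-< {s = 0} 0<c k<q)
  ... | inj₂ refl = ℕP.m<m+n (k * c) (digit-pos (ℕP.n≢0⇒n>0 r≢0))
    where
    r≢0 : t % D ≢ 0
    r≢0 r≡0 = ℕP.<-irrefl (sym (trans (m≡m%n+[m/n]*n t D) (cong (_+ t / D * D) r≡0))) kD<t

  floor-gap : ∀ t → + (suc c * t / D) ℤ.- + (t / D) ≡ + Φ t
  floor-gap t = trans (cong (λ x → + x ℤ.- + q) p*t/D≡) (xyx⁻¹≈y (+ q) (+ Φ t))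
    where
    open ≡-Reasoning
    q = t / D
    r = t % D
    p*t/D≡ : suc c * t / D ≡ q + Φ t
    p*t/D≡ = begin
      suc c * t / D                 ≡⟨ cong (λ x → suc c * x / D) (m≡m%n+[m/n]*n t D) ⟩
      suc c * (r + q * D) / D       ≡⟨ cong (_/ D) (ℕP.*-distribˡ-+ (suc c) r (q * D)) ⟩
      (suc c * r + suc c * (q * D)) / D ≡⟨ cong (λ x → (suc c * r + x) / D) (ℕP.*-assoc (suc c) q D) ⟨
      (suc c * r + suc c * q * D) / D ≡⟨ +-distrib-/-∣ʳ (suc c * r) (n∣m*n (suc c * q)) ⟩
      suc c * r / D + suc c * q * D / D ≡⟨ cong (λ x → suc c * r / D + x) (m*n/n≡m (suc c * q) D) ⟩
      suc c * r / D + suc c * q     ≡⟨ ℕP.+-comm (suc c * r / D) (suc c * q) ⟩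
      q + c * q + suc c * r / D     ≡⟨ ℕP.+-assoc q (c * q) (suc c * r / D) ⟩
      q + (c * q + suc c * r / D)   ≡⟨ cong (λ x → q + (x + suc c * r / D)) (ℕP.*-comm c q) ⟩
      q + Φ t                       ∎

module OnGrid (D : ℕ) {{_ : NonZero D}} where

  private instance
    D-pos : ℚ.Positive (ℕ→ℚ D)
    D-pos = ℕ→ℚ-pos D
    D-nonNeg : ℚ.NonNegative (ℕ→ℚ D)
    D-nonNeg = ℚP.pos⇒nonNeg (ℕ→ℚ D)

  infix 4 _≐_/D

  record _≐_/D (x : ℚ) (t : ℕ) : Set where
    constructor scaled
    field D*x≡t : ℕ→ℚ D ℚ.* x ≡ ℕ→ℚ t

  floor-/D : ∀ {x t} → x ≐ t /D → floor x ≡ + (t / D)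
  floor-/D {x} {t} (scaled x≐t) = floor-unique
    (ℚP.*-cancelˡ-≤-pos (ℕ→ℚ D) (subst₂ ℚ._≤_ (ℕ→ℚ-* D (t / D)) (sym x≐t)
      (ℕ→ℚ-mono-≤ (subst (_≤ t) (ℕP.*-comm (t / D) D) (m/n*n≤m t D)))))
    (ℚP.*-cancelˡ-<-nonNeg (ℕ→ℚ D) (subst₂ ℚ._<_ (sym x≐t) (ℕ→ℚ-* D (suc (t / D)))
      (ℕ→ℚ-mono-< (subst (t <_) (ℕP.*-comm (suc (t / D)) D) t<[t/D+1]*D))))
    where
    t<[t/D+1]*D : t < suc (t / D) * D
    t<[t/D+1]*D = subst (_< suc (t / D) * D) (sym (m≡m%n+[m/n]*n t D))
      (ℕP.+-monoˡ-< (t / D * D) (m%n<n t D))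

  ℕ-/D : ∀ k → ℕ→ℚ k ≐ k * D /D
  ℕ-/D k = scaled (trans (ℚP.*-comm (ℕ→ℚ D) (ℕ→ℚ k)) (sym (ℕ→ℚ-* k D)))

  *-/D : ∀ {x t} p → x ≐ t /D → ℕ→ℚ p ℚ.* x ≐ p * t /D
  *-/D {x} {t} p (scaled x≐t) = scaled (begin
    ℕ→ℚ D ℚ.* (ℕ→ℚ p ℚ.* x) ≡⟨ ℚP.*-assoc (ℕ→ℚ D) (ℕ→ℚ p) x ⟨
    ℕ→ℚ D ℚ.* ℕ→ℚ p ℚ.* x   ≡⟨ cong (ℚ._* x) (ℚP.*-comm (ℕ→ℚ D) (ℕ→ℚ p)) ⟩
    ℕ→ℚ p ℚ.* ℕ→ℚ D ℚ.* x   ≡⟨ ℚP.*-assoc (ℕ→ℚ p) (ℕ→ℚ D) x ⟩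
    ℕ→ℚ p ℚ.* (ℕ→ℚ D ℚ.* x) ≡⟨ cong (ℕ→ℚ p ℚ.*_) x≐t ⟩
    ℕ→ℚ p ℚ.* ℕ→ℚ t         ≡⟨ ℕ→ℚ-* p t ⟨
    ℕ→ℚ (p * t)             ∎)
    where open ≡-Reasoning

  /D-cancel-≤ : ∀ {x y t u} → x ≐ t /D → y ≐ u /D → x ℚ.≤ y → t ≤ u
  /D-cancel-≤ (scaled x≐t) (scaled y≐u) x≤y =
    ℕ→ℚ-cancel-≤ (subst₂ ℚ._≤_ x≐t y≐u (ℚP.*-monoˡ-≤-nonNeg (ℕ→ℚ D) x≤y))

  /D-cancel-< : ∀ {x y t u} → x ≐ t /D → y ≐ u /D → x ℚ.< y → t < u
  /D-cancel-< (scaled x≐t) (scaled y≐u) x<y =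
    ℕ→ℚ-cancel-< (subst₂ ℚ._<_ x≐t y≐u (ℚP.*-monoʳ-<-pos (ℕ→ℚ D) x<y))

module LatticePoints {n} (V : Vec (Vec ℤ n) n) {D} (isDenom : IsDenom V D) (c : ℕ) (D≤c : D ≤ c) where

  private instance
    D≢0 : NonZero D
    D≢0 = ℕ.>-nonZero (proj₁ isDenom)

  open OnGrid D
  open FloorGap D c D≤c

  weight-/D : ∀ Q → InM V Q → ∃[ t ] w Q ≐ t /D
  weight-/D Q mQ@(0≤Q , _) with w≡0⊎coordinate Q
  ... | inj₁ w≡0 = 0 , scaled (trans (cong (ℕ→ℚ D ℚ.*_) w≡0) (ℚP.*-zeroʳ (ℕ→ℚ D)))
  ... | inj₂ (i , w≡Qᵢ) with proj₂ isDenom Q mQ i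
  ...   | + t      , DQᵢ≡t = t , scaled (trans (cong (ℕ→ℚ D ℚ.*_) w≡Qᵢ) DQᵢ≡t)
  ...   | -[1+ j ] , DQᵢ≡m = ⊥-elim (0≰-[1+j] (ℤ→ℚ-cancel-≤ (subst (ℚ.0ℚ ℚ.≤_) DQᵢ≡m 0≤DQᵢ)))
    where
    0≰-[1+j] : ¬ (0ℤ ℤ.≤ -[1+ j ])
    0≰-[1+j] ()
    0≤DQᵢ : ℚ.0ℚ ℚ.≤ ℕ→ℚ D ℚ.* lookup Q i
    0≤DQᵢ = subst (ℚ._≤ ℕ→ℚ D ℚ.* lookup Q i) (ℚP.*-zeroʳ (ℕ→ℚ D))
      (ℚP.*-monoˡ-≤-nonNeg (ℕ→ℚ D) {{ℕ→ℚ-nonNeg D}} (0≤Q i))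

  hpt-/D : ∀ (Q : Vec ℚ n) {t} → w Q ≐ t /D → hpt (suc c) Q ≡ + Φ t
  hpt-/D Q {t} wQ≐t = trans
    (cong₂ ℤ._-_ (floor-/D (subst (_≐ suc c * t /D) (sym (w-scale (suc c) Q)) (*-/D (suc c) wQ≐t)))
                 (floor-/D wQ≐t))
    (floor-gap t)

  hpt-mono : ∀ Q Q' → InM V Q → InM V Q' → w Q ℚ.≤ w Q' → hpt (suc c) Q ℤ.≤ hpt (suc c) Q'
  hpt-mono Q Q' mQ mQ' wQ≤wQ' with weight-/D Q mQ | weight-/D Q' mQ'
  ... | t , wQ≐t | t' , wQ'≐t' = subst₂ ℤ._≤_ (sym (hpt-/D Q wQ≐t)) (sym (hpt-/D Q' wQ'≐t'))
    (ℤ.+≤+ (Φ-mono (/D-cancel-≤ wQ≐t wQ'≐t' wQ≤wQ')))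

  hpt-< : ∀ Q k → InM V Q → w Q ℚ.< ℕ→ℚ k → hpt (suc c) Q ℤ.< + (k * c)
  hpt-< Q k mQ wQ<k with weight-/D Q mQ
  ... | t , wQ≐t = subst (ℤ._< + (k * c)) (sym (hpt-/D Q wQ≐t))
    (ℤ.+<+ (Φ-< {k = k} (/D-cancel-< wQ≐t (ℕ-/D k) wQ<k)))

  hpt-> : ∀ Q k → InM V Q → ℕ→ℚ k ℚ.< w Q → + (k * c) ℤ.< hpt (suc c) Q
  hpt-> Q k mQ k<wQ with weight-/D Q mQ
  ... | t , wQ≐t = subst (+ (k * c) ℤ.<_) (sym (hpt-/D Q wQ≐t))
    (ℤ.+<+ (Φ-> {k = k} (/D-cancel-< (ℕ-/D k) wQ≐t k<wQ)))

  hpt-≡ : ∀ Q k → InM V Q → w Q ≡ ℕ→ℚ k → hpt (suc c) Q ≡ + (k * c)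
  hpt-≡ Q k mQ wQ≡k with weight-/D Q mQ
  ... | t , wQ≐t = trans (hpt-/D Q wQ≐t) (cong +_ (trans (cong Φ t≡kD) (Φ-multiple k)))
    where
    t≡kD : t ≡ k * D
    t≡kD = ℕP.≤-antisym (/D-cancel-≤ wQ≐t (ℕ-/D k) (ℚP.≤-reflexive wQ≡k))
                        (/D-cancel-≤ (ℕ-/D k) wQ≐t (ℚP.≤-reflexive (sym wQ≡k)))

module _ {A : Set} where

  ∈-─⁻ : ∀ {x y : A} {xs} (x∈xs : x ∈ xs) → y ∈ (xs ─ x∈xs) → y ∈ xs
  ∈-─⁻ (here _)      y∈            = there y∈
  ∈-─⁻ (there _)     (here y≡)     = here y≡
  ∈-─⁻ (there x∈xs) (there y∈) = there (∈-─⁻ x∈xs y∈)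

  ∈-─⁺ : ∀ {x y : A} {xs} (x∈xs : x ∈ xs) → y ∈ xs → y ≢ x → y ∈ (xs ─ x∈xs)
  ∈-─⁺ (here refl)  (here refl) y≢x = ⊥-elim (y≢x refl)
  ∈-─⁺ (here refl)  (there y∈)  _   = y∈
  ∈-─⁺ (there _)    (here refl) _   = here refl
  ∈-─⁺ (there x∈xs) (there y∈)  y≢x = there (∈-─⁺ x∈xs y∈ y≢x)

  Unique-─ : ∀ {x : A} {xs} → Unique xs → (x∈xs : x ∈ xs) → Unique (xs ─ x∈xs)
  Unique-─ (_    ∷ u) (here _)     = u
  Unique-─ (y≢xs ∷ u) (there x∈xs) = ─⁺ x∈xs y≢xs ∷ Unique-─ u x∈xs

  length-─ : ∀ {x : A} {xs} (x∈xs : x ∈ xs) → length xs ≡ suc (length (xs ─ x∈xs))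
  length-─ {xs = xs} x∈xs = length-removeAt′ xs (index x∈xs)

  sum-─ : ∀ (f : A → ℤ) {x xs} (x∈xs : x ∈ xs) →
          sumℤ (List.map f xs) ≡ f x ℤ.+ sumℤ (List.map f (xs ─ x∈xs))
  sum-─ f (here refl) = refl
  sum-─ f {x} (there {y} {xs} x∈xs) = trans (cong (λ s → f y ℤ.+ s) (sum-─ f x∈xs))
    (ℤ-+.x∙yz≈y∙xz (f y) (f x) (sumℤ (List.map f (xs ─ x∈xs))))

  Unique⇒length≤ : ∀ {xs ys : List A} → Unique xs → All (_∈ ys) xs → length xs ≤ length ys
  Unique⇒length≤ []            []            = z≤n
  Unique⇒length≤ {ys = ys} (x≢xs ∷ u) (x∈ys ∷ xs⊆ys) =
    subst (_ ≤_) (sym (length-─ x∈ys)) (s≤s (Unique⇒length≤ u xs⊆ys─x))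
    where
    xs⊆ys─x = All.zipWith (λ (x≢y , y∈ys) → ∈-─⁺ x∈ys y∈ys (x≢y ∘ sym)) (x≢xs , xs⊆ys)

  module _ (_≟_ : DecidableEquality A) where
    open DecMembership _≟_ using (_∈?_)

    longer⇒∃∉ : ∀ {xs ys : List A} → Unique xs → length ys < length xs → ∃[ x ] x ∈ xs × x ∉ ys
    longer⇒∃∉ {xs} {ys} u ys<xs with all? (_∈? ys) xs
    ... | yes xs⊆ys = ⊥-elim (ℕP.<⇒≱ ys<xs (Unique⇒length≤ u xs⊆ys))
    ... | no  xs⊈ys = find (¬All⇒Any¬ (_∈? ys) xs xs⊈ys)

module WSets {n} (V : Vec (Vec ℤ n) n) (p : ℕ)
  (hpt-mono : ∀ Q Q' → InM V Q → InM V Q' → w Q ℚ.≤ w Q' → hpt p Q ℤ.≤ hpt p Q') where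

  private
    _≟_ : DecidableEquality (Vec ℚ n)
    _≟_ = VecP.≡-dec ℚP._≟_
  open DecMembership _≟_ using (_∈?_)

  Heaviest : List (Vec ℚ n) → Vec ℚ n → Set
  Heaviest S q = All (λ Q → w Q ℚ.≤ w q) S

  IsSubsetM-─ : ∀ {S q} → IsSubsetM V S → (q∈S : q ∈ S) → IsSubsetM V (S ─ q∈S)
  IsSubsetM-─ (uS , mS) q∈S = Unique-─ uS q∈S , ─⁺ q∈S mS

  record Peeled (ℓ : ℕ) (S : List (Vec ℚ n)) : Set where
    field
      top      : Vec ℚ n
      top∈S    : top ∈ S
      heaviest : Heaviest S top
      rest-W   : IsW V p ℓ (S ─ top∈S)

  IsW-─ : ∀ {ℓ S q} → IsW V p (suc ℓ) S → (q∈S : q ∈ S) → Heaviest S q → IsW V p ℓ (S ─ q∈S)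
  IsW-─ {S = S} {q} (subset , |S| , lightest) q∈S heavy =
    IsSubsetM-─ subset q∈S , ℕP.suc-injective (trans (sym (length-─ q∈S)) |S|) , lightest'
    where
    lightest' : ∀ Q Q' → Q ∈ (S ─ q∈S) → InM V Q' → Q' ∉ (S ─ q∈S) → w Q ℚ.≤ w Q'
    lightest' Q Q' Q∈ mQ' Q'∉ with Q' ≟ q
    ... | yes refl  = All.lookup heavy (∈-─⁻ q∈S Q∈)
    ... | no  Q'≢q = lightest Q Q' (∈-─⁻ q∈S Q∈) mQ' (λ Q'∈S → Q'∉ (∈-─⁺ q∈S Q'∈S Q'≢q))

  peel : ∀ {ℓ S} → IsW V p (suc ℓ) S → Peeled ℓ S
  peel {S = x ∷ xs} W = record
    { top = argmax w x xs ; top∈S = top∈S ; heaviest = heavy ; rest-W = IsW-─ W top∈S heavy }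
    where
    top∈S : argmax w x xs ∈ x ∷ xs
    top∈S = [ here , there ]′ (argmax-sel w x xs)
    heavy : Heaviest (x ∷ xs) (argmax w x xs)
    heavy = f[⊥]≤f[argmax] {f = w} x xs ∷ f[xs]≤f[argmax] x xs

  W-minimal : ∀ ℓ {T S} → IsW V p ℓ T → IsSubsetM V S → length S ≡ ℓ → h p T ℤ.≤ h p S
  W-minimal zero {[]}    {[]}    _            _ _  = ℤP.≤-refl
  W-minimal zero {[]}    {_ ∷ _} _            _ ()
  W-minimal zero {_ ∷ _}         (_ , () , _) _ _
  W-minimal (suc ℓ) {T} {S} WT subS@(uS , mS) |S| with peel WT
  ... | record { top = q ; top∈S = q∈T ; rest-W = WT' } with q ∈? S
  ...   | yes q∈S = begin
    h p T                   ≡⟨ sum-─ (hpt p) q∈T ⟩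
    hpt p q ℤ.+ h p (T ─ q∈T) ≤⟨ ℤP.+-monoʳ-≤ (hpt p q) (W-minimal ℓ WT' (IsSubsetM-─ subS q∈S) |S─q|) ⟩
    hpt p q ℤ.+ h p (S ─ q∈S) ≡⟨ sum-─ (hpt p) q∈S ⟨
    h p S                   ∎
    where
    open ℤP.≤-Reasoning
    |S─q| = ℕP.suc-injective (trans (sym (length-─ q∈S)) |S|)
  ...   | no q∉S with longer⇒∃∉ _≟_ uS (subst (_< length S) (sym (proj₁ (proj₂ WT'))) (ℕP.≤-reflexive (sym |S|)))
  ...     | s , s∈S , s∉T─q = begin
    h p T                   ≡⟨ sum-─ (hpt p) q∈T ⟩
    hpt p q ℤ.+ h p (T ─ q∈T) ≤⟨ ℤP.+-mono-≤ q≤s (W-minimal ℓ WT' (IsSubsetM-─ subS s∈S) |S─s|) ⟩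
    hpt p s ℤ.+ h p (S ─ s∈S) ≡⟨ sum-─ (hpt p) s∈S ⟨
    h p S                   ∎
    where
    open ℤP.≤-Reasoning
    |S─s| = ℕP.suc-injective (trans (sym (length-─ s∈S)) |S|)
    s∉T : s ∉ T
    s∉T s∈T = s∉T─q (∈-─⁺ q∈T s∈T (λ { refl → q∉S s∈S }))
    q≤s : hpt p q ℤ.≤ hpt p s
    q≤s = hpt-mono q s (All.lookup (proj₂ (proj₁ WT)) q∈T) (All.lookup mS s∈S)
      (proj₂ (proj₂ WT) q s q∈T (All.lookup mS s∈S) s∉T)

  HW-functional : ∀ {ℓ y y'} → HW V p ℓ y → HW V p ℓ y' → y ≡ y'
  HW-functional (S , WS , refl) (T , WT , refl) = ℤP.≤-antisym
    (W-minimal _ WS (proj₁ WT) (proj₁ (proj₂ WT)))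
    (W-minimal _ WT (proj₁ WS) (proj₁ (proj₂ WS)))

  W-down : ∀ {b ℓ S} → IsW V p b S → ℓ ≤′ b → ∃[ S' ] IsW V p ℓ S' × All (_∈ S) S'
  W-down W ≤′-refl = _ , W , All.tabulate (λ x∈ → x∈)
  W-down W (≤′-step ℓ≤′b) with peel W
  ... | record { top∈S = q∈S ; rest-W = W' } with W-down W' ℓ≤′b
  ...   | S' , W'' , S'⊆S─q = S' , W'' , All.map (∈-─⁻ q∈S) S'⊆S─q

  HW-down : ∀ {b yb} ℓ → HW V p b yb → ℓ ≤ b → ∃[ y ] HW V p ℓ y
  HW-down ℓ (S , W , _) ℓ≤b with W-down W (ℕP.≤⇒≤′ ℓ≤b)
  ... | S' , W' , _ = h p S' , S' , W' , refl

  HW-step : ∀ {m S ya yb} (W : IsW V p (suc m) S) → HW V p m ya → HW V p (suc m) yb →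
            yb ℤ.- ya ≡ hpt p (Peeled.top (peel W))
  HW-step {S = S} {ya} {yb} W hw-a hw-b = begin
    yb ℤ.- ya                              ≡⟨ cong₂ ℤ._-_ (HW-functional hw-b (S , W , refl)) (HW-functional hw-a ((S ─ q∈S) , W' , refl)) ⟩
    h p S ℤ.- h p (S ─ q∈S)                 ≡⟨ cong (ℤ._- h p (S ─ q∈S)) (trans (sum-─ (hpt p) q∈S) (ℤP.+-comm (hpt p q) _)) ⟩
    h p (S ─ q∈S) ℤ.+ hpt p q ℤ.- h p (S ─ q∈S) ≡⟨ xyx⁻¹≈y (h p (S ─ q∈S)) (hpt p q) ⟩
    hpt p q                                ∎
    where
    open ≡-Reasoning
    open Peeled (peel W) renaming (top to q; top∈S to q∈S; rest-W to W')

  HW-convex : ∀ {m a b c} → HW V p m a → HW V p (suc m) b → HW V p (suc (suc m)) c → b ℤ.- a ℤ.≤ c ℤ.- b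
  HW-convex hw-a hw-b hw-c@(S , W , _) = subst₂ ℤ._≤_ (sym (HW-step W' hw-a hw-b)) (sym (HW-step W hw-b hw-c))
    (hpt-mono q' q (All.lookup mS (∈-─⁻ q∈S q'∈S─q)) (All.lookup mS q∈S) (All.lookup heaviest (∈-─⁻ q∈S q'∈S─q)))
    where
    mS = proj₂ (proj₁ W)
    open Peeled (peel W) renaming (top to q; top∈S to q∈S; rest-W to W')
    open Peeled (peel W') using () renaming (top to q'; top∈S to q'∈S─q)

cross-≤ : ∀ k₁ k₂ {A B d} → A ℤ.≤ + k₁ ℤ.* d → + k₂ ℤ.* d ℤ.≤ B → + k₂ ℤ.* A ℤ.≤ + k₁ ℤ.* B
cross-≤ k₁ k₂ {A} {B} {d} A≤k₁d k₂d≤B = begin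
  + k₂ ℤ.* A            ≤⟨ ℤP.*-monoˡ-≤-nonNeg (+ k₂) A≤k₁d ⟩
  + k₂ ℤ.* (+ k₁ ℤ.* d) ≡⟨ ℤ-*.x∙yz≈y∙xz (+ k₂) (+ k₁) d ⟩
  + k₁ ℤ.* (+ k₂ ℤ.* d) ≤⟨ ℤP.*-monoˡ-≤-nonNeg (+ k₁) k₂d≤B ⟩
  + k₁ ℤ.* B            ∎
  where open ℤP.≤-Reasoning

cross-< : ∀ k₁ k₂ {A B d₀ d} → A ℤ.≤ + suc k₁ ℤ.* d₀ → d₀ ℤ.< d → + suc k₂ ℤ.* d ℤ.≤ B →
          + suc k₂ ℤ.* A ℤ.< + suc k₁ ℤ.* B
cross-< k₁ k₂ {A} {B} {d₀} {d} A≤k₁d₀ d₀<d k₂d≤B = begin-strict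
  + suc k₂ ℤ.* A                  ≤⟨ ℤP.*-monoˡ-≤-nonNeg (+ suc k₂) A≤k₁d₀ ⟩
  + suc k₂ ℤ.* (+ suc k₁ ℤ.* d₀)  <⟨ ℤP.*-monoˡ-<-pos (+ suc k₂) (ℤP.*-monoˡ-<-pos (+ suc k₁) d₀<d) ⟩
  + suc k₂ ℤ.* (+ suc k₁ ℤ.* d)   ≡⟨ ℤ-*.x∙yz≈y∙xz (+ suc k₂) (+ suc k₁) d ⟩
  + suc k₁ ℤ.* (+ suc k₂ ℤ.* d)   ≤⟨ ℤP.*-monoˡ-≤-nonNeg (+ suc k₁) k₂d≤B ⟩
  + suc k₁ ℤ.* B                  ∎
  where open ℤP.≤-Reasoning

module _ (ya yx yb : ℤ) (k₁ k₂ : ℕ) where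

  private
    E = ya ℤ.* + k₂ ℤ.+ yx ℤ.* + k₁
    open +-*-Solver

    lhs : + k₂ ℤ.* (yx ℤ.- ya) ℤ.+ E ≡ yx ℤ.* + (k₂ + k₁)
    lhs = trans (solve 4 (λ ya yx K₁ K₂ → K₂ :* (yx :- ya) :+ (ya :* K₂ :+ yx :* K₁) := yx :* (K₂ :+ K₁))
                 refl ya yx (+ k₁) (+ k₂))
                (cong (yx ℤ.*_) (sym (ℤP.pos-+ k₂ k₁)))

    rhs : + k₁ ℤ.* (yb ℤ.- yx) ℤ.+ E ≡ ya ℤ.* + k₂ ℤ.+ yb ℤ.* + k₁
    rhs = solve 5 (λ ya yx yb K₁ K₂ → K₁ :* (yb :- yx) :+ (ya :* K₂ :+ yx :* K₁) := ya :* K₂ :+ yb :* K₁)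
                refl ya yx yb (+ k₁) (+ k₂)

  slopes⇒chord : + k₂ ℤ.* (yx ℤ.- ya) ℤ.≤ + k₁ ℤ.* (yb ℤ.- yx) →
                 yx ℤ.* + (k₂ + k₁) ℤ.≤ ya ℤ.* + k₂ ℤ.+ yb ℤ.* + k₁
  slopes⇒chord le = subst₂ ℤ._≤_ lhs rhs (ℤP.+-monoˡ-≤ E le)

  slopes⇒chord-< : + k₂ ℤ.* (yx ℤ.- ya) ℤ.< + k₁ ℤ.* (yb ℤ.- yx) →
                   yx ℤ.* + (k₂ + k₁) ℤ.< ya ℤ.* + k₂ ℤ.+ yb ℤ.* + k₁
  slopes⇒chord-< lt = subst₂ ℤ._<_ lhs rhs (ℤP.+-monoˡ-< E lt)

chord-cast : ∀ ya yb k₁ k₂ →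
             ℤ→ℚ (ya ℤ.* + k₂ ℤ.+ yb ℤ.* + k₁) ≡ ℤ→ℚ ya ℚ.* ℕ→ℚ k₂ ℚ.+ ℤ→ℚ yb ℚ.* ℕ→ℚ k₁
chord-cast ya yb k₁ k₂ =
  trans (ℤ→ℚ-+ (ya ℤ.* + k₂) (yb ℤ.* + k₁)) (cong₂ ℚ._+_ (ℤ→ℚ-*ℕ ya k₂) (ℤ→ℚ-*ℕ yb k₁))

-- s, t, u are the lengths b ∸ a, b ∸ x, x ∸ a of a chord; taking them as arguments
-- together with their values avoids reducing ℕ→ℚ on ∸-terms.
module _ (ya yx yb : ℤ) (k₁ k₂ s t u : ℕ) (s≡ : s ≡ k₂ + k₁) (t≡ : t ≡ k₂) (u≡ : u ≡ k₁) where

  chord-ℚ : yx ℤ.* + (k₂ + k₁) ℤ.≤ ya ℤ.* + k₂ ℤ.+ yb ℤ.* + k₁ →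
            ℤ→ℚ yx ℚ.* ℕ→ℚ s ℚ.≤ ℤ→ℚ ya ℚ.* ℕ→ℚ t ℚ.+ ℤ→ℚ yb ℚ.* ℕ→ℚ u
  chord-ℚ le rewrite s≡ | t≡ | u≡ =
    subst₂ ℚ._≤_ (ℤ→ℚ-*ℕ yx (k₂ + k₁)) (chord-cast ya yb k₁ k₂) (ℤ→ℚ-mono-≤ le)

  chord-ℚ-< : yx ℤ.* + (k₂ + k₁) ℤ.< ya ℤ.* + k₂ ℤ.+ yb ℤ.* + k₁ →
              ℤ→ℚ yx ℚ.* ℕ→ℚ s ℚ.< ℤ→ℚ ya ℚ.* ℕ→ℚ t ℚ.+ ℤ→ℚ yb ℚ.* ℕ→ℚ u
  chord-ℚ-< lt rewrite s≡ | t≡ | u≡ =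
    subst₂ ℚ._<_ (ℤ→ℚ-*ℕ yx (k₂ + k₁)) (chord-cast ya yb k₁ k₂) (ℤ→ℚ-mono-< lt)

offset-∸ : ∀ k₂ k₁ a → k₂ + (k₁ + a) ∸ a ≡ k₂ + k₁
offset-∸ k₂ k₁ a = trans (cong (_∸ a) (sym (ℕP.+-assoc k₂ k₁ a))) (ℕP.m+n∸n≡m (k₂ + k₁) a)

module Hull {n} (V : Vec (Vec ℤ n) n) (p : ℕ)
  (functional : ∀ {ℓ y y'} → HW V p ℓ y → HW V p ℓ y' → y ≡ y')
  (down : ∀ {b yb} ℓ → HW V p b yb → ℓ ≤ b → ∃[ y ] HW V p ℓ y)
  (convex : ∀ {m a b c} → HW V p m a → HW V p (suc m) b → HW V p (suc (suc m)) c →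
            b ℤ.- a ℤ.≤ c ℤ.- b) where

  private
    H = HW V p

  secant-≤-last : ∀ k {a ya y₀ yx} → H a ya → H (k + a) y₀ → H (suc (k + a)) yx →
                  yx ℤ.- ya ℤ.≤ + suc k ℤ.* (yx ℤ.- y₀)
  secant-≤-last zero ha h₀ hx rewrite functional h₀ ha = ℤP.≤-reflexive (sym (ℤP.*-identityˡ _))
  secant-≤-last (suc k) {a} {ya} {y₀} {yx} ha h₀ hx = begin
    yx ℤ.- ya                               ≡⟨ ℤP.+-minus-telescope yx y₀ ya ⟨
    (yx ℤ.- y₀) ℤ.+ (y₀ ℤ.- ya)              ≤⟨ ℤP.+-monoʳ-≤ (yx ℤ.- y₀) (ℤP.≤-trans (secant-≤-last k ha h₋ h₀)
                                                  (ℤP.*-monoˡ-≤-nonNeg (+ suc k) (convex h₋ h₀ hx))) ⟩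
    (yx ℤ.- y₀) ℤ.+ + suc k ℤ.* (yx ℤ.- y₀)  ≡⟨ ℤP.suc-* (+ suc k) (yx ℤ.- y₀) ⟨
    + suc (suc k) ℤ.* (yx ℤ.- y₀)           ∎
    where
    open ℤP.≤-Reasoning
    h₋ = proj₂ (down (k + a) h₀ (ℕP.n≤1+n _))

  first-≤-secant : ∀ k {x yx yx₁ yb} → H x yx → H (suc x) yx₁ → H (k + x) yb →
                   + k ℤ.* (yx₁ ℤ.- yx) ℤ.≤ yb ℤ.- yx
  first-≤-secant zero          {yx = yx} hx hx₁ hb rewrite functional hb hx = ℤP.≤-reflexive (sym (ℤP.+-inverseʳ yx))
  first-≤-secant (suc zero)    hx hx₁ hb rewrite functional hb hx₁ = ℤP.≤-reflexive (ℤP.*-identityˡ _)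
  first-≤-secant (suc (suc k)) {x} {yx} {yx₁} {yb} hx hx₁ hb = begin
    + suc (suc k) ℤ.* (yx₁ ℤ.- yx)          ≡⟨ ℤP.suc-* (+ suc k) (yx₁ ℤ.- yx) ⟩
    (yx₁ ℤ.- yx) ℤ.+ + suc k ℤ.* (yx₁ ℤ.- yx) ≤⟨ ℤP.+-monoʳ-≤ (yx₁ ℤ.- yx) (ℤP.≤-trans
                                                  (ℤP.*-monoˡ-≤-nonNeg (+ suc k) (convex hx hx₁ hx₂))
                                                  (first-≤-secant (suc k) hx₁ hx₂ hb')) ⟩
    (yx₁ ℤ.- yx) ℤ.+ (yb ℤ.- yx₁)           ≡⟨ ℤP.+-comm (yx₁ ℤ.- yx) (yb ℤ.- yx₁) ⟩
    (yb ℤ.- yx₁) ℤ.+ (yx₁ ℤ.- yx)           ≡⟨ ℤP.+-minus-telescope yb yx₁ yx ⟩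
    yb ℤ.- yx                               ∎
    where
    open ℤP.≤-Reasoning
    hx₂ = proj₂ (down (suc (suc x)) hb (s≤s (s≤s (ℕP.m≤n+m x k))))
    hb' : H (suc k + suc x) yb
    hb' = subst (λ i → H i yb) (cong suc (sym (ℕP.+-suc k x))) hb

  secant-≤-next : ∀ k {a ya yx yx₁} → H a ya → H (k + a) yx → H (suc (k + a)) yx₁ →
                  yx ℤ.- ya ℤ.≤ + k ℤ.* (yx₁ ℤ.- yx)
  secant-≤-next zero    {ya = ya} ha hx hx₁ rewrite functional hx ha = ℤP.≤-reflexive (ℤP.+-inverseʳ ya)
  secant-≤-next (suc k) {a} ha hx hx₁ =
    ℤP.≤-trans (secant-≤-last k ha h₀ hx) (ℤP.*-monoˡ-≤-nonNeg (+ suc k) (convex h₀ hx hx₁))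
    where h₀ = proj₂ (down (k + a) hx (ℕP.n≤1+n _))

  secants : ∀ k₁ k₂ {a ya yx yb} → H a ya → H (k₁ + a) yx → H (k₂ + (k₁ + a)) yb →
            + k₂ ℤ.* (yx ℤ.- ya) ℤ.≤ + k₁ ℤ.* (yb ℤ.- yx)
  secants k₁ zero {yx = yx} {yb} ha hx hb = ℤP.≤-reflexive (sym (begin
    + k₁ ℤ.* (yb ℤ.- yx) ≡⟨ cong (λ y → + k₁ ℤ.* (y ℤ.- yx)) (functional hb hx) ⟩
    + k₁ ℤ.* (yx ℤ.- yx) ≡⟨ cong (+ k₁ ℤ.*_) (ℤP.+-inverseʳ yx) ⟩
    + k₁ ℤ.* 0ℤ          ≡⟨ ℤP.*-zeroʳ (+ k₁) ⟩
    0ℤ                   ∎))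
    where open ≡-Reasoning
  secants k₁ (suc k₂) {a} ha hx hb =
    cross-≤ k₁ (suc k₂) (secant-≤-next k₁ ha hx hx₁) (first-≤-secant (suc k₂) hx hx₁ hb)
    where hx₁ = proj₂ (down (suc (k₁ + a)) hb (s≤s (ℕP.m≤n+m (k₁ + a) k₂)))

  secants-< : ∀ k₁ k₂ {a ya yx yb} → H a ya → H (suc k₁ + a) yx → H (suc k₂ + (suc k₁ + a)) yb →
              (∀ {y₀ y₁} → H (k₁ + a) y₀ → H (suc (suc k₁ + a)) y₁ → yx ℤ.- y₀ ℤ.< y₁ ℤ.- yx) →
              + suc k₂ ℤ.* (yx ℤ.- ya) ℤ.< + suc k₁ ℤ.* (yb ℤ.- yx)
  secants-< k₁ k₂ {a} ha hx hb kink =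
    cross-< k₁ k₂ (secant-≤-last k₁ ha h₀ hx) (kink h₀ h₁) (first-≤-secant (suc k₂) hx h₁ hb)
    where
    h₀ = proj₂ (down (k₁ + a) hx (ℕP.n≤1+n _))
    h₁ = proj₂ (down (suc (suc k₁ + a)) hb (s≤s (ℕP.m≤n+m _ k₂)))

  HW⇒BelowChords : ∀ {x yx} → H x yx → BelowChords V p x (ℤ→ℚ yx)
  HW⇒BelowChords {x} {yx} hx a b ya yb a≤x x≤b _ ha hb =
    chord-ℚ ya yx yb k₁ k₂ (b ∸ a) (b ∸ x) (x ∸ a) b-a≡ refl refl
      (slopes⇒chord ya yx yb k₁ k₂ (secants k₁ k₂ ha hx' hb'))
    where
    k₁ = x ∸ a
    k₂ = b ∸ x
    x≡ : x ≡ k₁ + a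
    x≡ = sym (ℕP.m∸n+n≡m a≤x)
    b≡ : b ≡ k₂ + (k₁ + a)
    b≡ = trans (sym (ℕP.m∸n+n≡m x≤b)) (cong (λ i → k₂ + i) x≡)
    b-a≡ : b ∸ a ≡ k₂ + k₁
    b-a≡ = trans (cong (_∸ a) b≡) (offset-∸ k₂ k₁ a)
    hx' = subst (λ i → H i yx) x≡ hx
    hb' = subst (λ i → H i yb) b≡ hb

  -- The kink is stated with suc m ≡ x so that x need not be a syntactic successor.
  IsVertex-of-kink : ∀ {x y} → 1 ≤ x → H x y →
                     (∀ {m y₀ y₁} → suc m ≡ x → H m y₀ → H (suc x) y₁ → y ℤ.- y₀ ℤ.< y₁ ℤ.- y) →
                     IsVertex V p x y
  IsVertex-of-kink {suc x} {y} _ hx kink = hx , chord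
    where
    chord : ∀ a b ya yb → a < suc x → suc x < b → H a ya → H b yb →
            ℤ→ℚ y ℚ.* ℕ→ℚ (b ∸ a) ℚ.< ℤ→ℚ ya ℚ.* ℕ→ℚ (b ∸ suc x) ℚ.+ ℤ→ℚ yb ℚ.* ℕ→ℚ (suc x ∸ a)
    chord a b ya yb a<x x<b ha hb =
      chord-ℚ-< ya y yb (suc k₁) (suc k₂) (b ∸ a) (b ∸ suc x) (suc x ∸ a)
        (trans (cong (_∸ a) b≡) (offset-∸ (suc k₂) (suc k₁) a))
        (trans (cong (_∸ suc x) b≡') (ℕP.m+n∸n≡m (suc k₂) (suc x)))
        (trans (cong (λ i → suc i ∸ a) x≡) (ℕP.m+n∸n≡m (suc k₁) a))
        (slopes⇒chord-< ya y yb (suc k₁) (suc k₂) (secants-< k₁ k₂ ha hx' hb' kink'))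
      where
      k₁ = x ∸ a
      k₂ = b ∸ suc (suc x)
      x≡ : x ≡ k₁ + a
      x≡ = sym (ℕP.m∸n+n≡m (ℕP.≤-pred a<x))
      b≡' : b ≡ suc k₂ + suc x
      b≡' = trans (sym (ℕP.m∸n+n≡m x<b)) (ℕP.+-suc k₂ (suc x))
      b≡ : b ≡ suc k₂ + (suc k₁ + a)
      b≡ = trans b≡' (cong (λ i → suc k₂ + suc i) x≡)
      hx' = subst (λ i → H (suc i) y) x≡ hx
      hb' = subst (λ i → H i yb) b≡ hb
      kink' : ∀ {y₀ y₁} → H (k₁ + a) y₀ → H (suc (suc k₁ + a)) y₁ → y ℤ.- y₀ ℤ.< y₁ ℤ.- y
      kink' {y₀} {y₁} h₀ h₁ =
        kink refl (subst (λ i → H i y₀) (sym x≡) h₀) (subst (λ i → H (suc (suc i)) y₁) (sym x≡) h₁)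

  IHPval-right : ∀ {x y₀ y₁} → H x y₀ → H (suc x) y₁ → IHPval V p (suc x) (ℤ→ℚ y₁)
  IHPval-right {x} {y₀} {y₁} h₀ h₁ = HW⇒BelowChords h₁ , λ y below →
    last-point {y} {ℤ→ℚ y₀} {ℤ→ℚ y₁} (suc x ∸ x) (suc x ∸ suc x) (ℕP.m+n∸n≡m 1 x) (ℕP.n∸n≡0 x)
      (below x (suc x) y₀ y₁ (ℕP.n≤1+n x) ℕP.≤-refl (ℕP.n<1+n x) h₀ h₁)
    where
    last-point : ∀ {y A B} s t → s ≡ 1 → t ≡ 0 →
                 y ℚ.* ℕ→ℚ s ℚ.≤ A ℚ.* ℕ→ℚ t ℚ.+ B ℚ.* ℕ→ℚ s → y ℚ.≤ B
    last-point {y} {A} {B} _ _ refl refl = subst₂ ℚ._≤_ (ℚP.*-identityʳ y)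
      (trans (cong₂ ℚ._+_ (ℚP.*-zeroʳ A) (ℚP.*-identityʳ B)) (ℚP.+-identityˡ B))

  IHPval-left : ∀ {x y₀ y₁} → H x y₀ → H (suc x) y₁ → IHPval V p x (ℤ→ℚ y₀)
  IHPval-left {x} {y₀} {y₁} h₀ h₁ = HW⇒BelowChords h₀ , λ y below →
    first-point {y} {ℤ→ℚ y₀} {ℤ→ℚ y₁} (suc x ∸ x) (x ∸ x) (ℕP.m+n∸n≡m 1 x) (ℕP.n∸n≡0 x)
      (below x (suc x) y₀ y₁ ℕP.≤-refl (ℕP.n≤1+n x) (ℕP.n<1+n x) h₀ h₁)
    where
    first-point : ∀ {y A B} s t → s ≡ 1 → t ≡ 0 →
                  y ℚ.* ℕ→ℚ s ℚ.≤ A ℚ.* ℕ→ℚ s ℚ.+ B ℚ.* ℕ→ℚ t → y ℚ.≤ A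
    first-point {y} {A} {B} _ _ refl refl = subst₂ ℚ._≤_ (ℚP.*-identityʳ y)
      (trans (cong₂ ℚ._+_ (ℚP.*-identityʳ A) (ℚP.*-zeroʳ B)) (ℚP.+-identityʳ A))

  IHPval-of-pos : ∀ {x y} → 1 ≤ x → H x y → IHPval V p x (ℤ→ℚ y)
  IHPval-of-pos {suc x} _ hx = IHPval-right (proj₂ (down x hx (ℕP.n≤1+n x))) hx

  IHPval-of-below : ∀ {x y b yb} → x < b → H x y → H b yb → IHPval V p x (ℤ→ℚ y)
  IHPval-of-below {x} x<b hx hb = IHPval-left hx (proj₂ (down (suc x) hb x<b))

  IHPval-unique : ∀ {x y y'} → IHPval V p x y → IHPval V p x y' → y ≡ y'
  IHPval-unique (below , sup) (below' , sup') = ℚP.≤-antisym (sup' _ below) (sup _ below')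

  -- Without points of the sequence at or beyond x every y would lie below all chords at x.
  IHPval⇒¬¬HW : ∀ {x y} → IHPval V p x y → ¬ ¬ (∃[ b ] x ≤ b × ∃[ yb ] H b yb)
  IHPval⇒¬¬HW {x} {y} (_ , sup) none = ℚP.<-irrefl refl (ℚP.<-≤-trans y<y+1 (sup (y ℚ.+ ℚ.1ℚ) vacuous))
    where
    vacuous : BelowChords V p x (y ℚ.+ ℚ.1ℚ)
    vacuous _ b _ yb _ x≤b _ _ hb = ⊥-elim (none (b , x≤b , yb , hb))
    y<y+1 : y ℚ.< y ℚ.+ ℚ.1ℚ
    y<y+1 = subst (ℚ._< y ℚ.+ ℚ.1ℚ) (ℚP.+-identityʳ y) (ℚP.+-monoʳ-< y (ℕ→ℚ-mono-< {0} {1} (s≤s z≤n)))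

  SlopeAt-of-increments : ∀ {m} (P : ℚ → Set) → (∀ s → Dec (P s)) →
    (∀ {y₀ y₁} → H m y₀ → H (suc m) y₁ → P (ℤ→ℚ (y₁ ℤ.- y₀))) → SlopeAt V p m P
  SlopeAt-of-increments {m} P P? increment y y' ihp ihp' =
    decidable-stable (P? _) λ ¬P → IHPval⇒¬¬HW ihp' λ (b , m<b , yb , hb) → ¬P (slope m<b hb)
    where
    slope : ∀ {b yb} → suc m ≤ b → H b yb → P (y' ℚ.- y)
    slope m<b hb = subst P
      (trans (ℤ→ℚ-- y₁ y₀) (cong₂ ℚ._-_ (IHPval-unique (IHPval-right h₀ h₁) ihp')
                                          (IHPval-unique (IHPval-left h₀ h₁) ihp)))
      (increment h₀ h₁)
      where
      y₀ = proj₁ (down m hb (ℕP.<⇒≤ m<b))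
      h₀ = proj₂ (down m hb (ℕP.<⇒≤ m<b))
      y₁ = proj₁ (down (suc m) hb m<b)
      h₁ = proj₂ (down (suc m) hb m<b)

ΣℚFin-zeros : ∀ m (g : Fin m → ℚ) → (∀ i → g i ≡ ℚ.0ℚ) → ΣℚFin m g ≡ ℚ.0ℚ
ΣℚFin-zeros zero    g g≡0 = refl
ΣℚFin-zeros (suc m) g g≡0 = trans (cong₂ ℚ._+_ (g≡0 zero) (ΣℚFin-zeros m (g ∘ suc) (g≡0 ∘ suc)))
                                  (ℚP.+-identityˡ ℚ.0ℚ)

module Corollary {n'} (V : Vec (Vec ℤ (suc n')) (suc n')) {D} (isD : IsD V D) (c : ℕ) (D≤c : D ≤ c)
  (k : ℕ) {L⁺} (E⁺ : Enumerates V (InΔ⁺ V k) L⁺) {L⁻} (E⁻ : Enumerates V (InΔ⁻ V k) L⁻) where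

  open LatticePoints V (proj₁ isD) c D≤c
  open WSets V (suc c) hpt-mono
  open Hull V (suc c) HW-functional HW-down HW-convex

  private
    K : ℤ
    K = + (k * c)
    0≤k : ℚ.0ℚ ℚ.≤ ℕ→ℚ k
    0≤k = 0≤ℕ→ℚ k

  ∈L⁺⇒ : ∀ {Q} → Q ∈ L⁺ → InM V Q × w Q ℚ.≤ ℕ→ℚ k
  ∈L⁺⇒ {Q} Q∈ = proj₁ Q∈Δ , w-lub Q 0≤k (proj₂ Q∈Δ)
    where Q∈Δ = Equivalence.to (proj₂ E⁺ Q) Q∈

  ⇒∈L⁺ : ∀ {Q} → InM V Q → w Q ℚ.≤ ℕ→ℚ k → Q ∈ L⁺
  ⇒∈L⁺ {Q} mQ wQ≤k = Equivalence.from (proj₂ E⁺ Q) (mQ , λ i → ℚP.≤-trans (w-ub Q i) wQ≤k)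

  ∈L⁻⇒ : ∀ {Q} → Q ∈ L⁻ → InM V Q × w Q ℚ.< ℕ→ℚ k
  ∈L⁻⇒ {Q} Q∈ = mQ , w-lub< Q (ℚP.≤-<-trans (proj₁ mQ zero) (Q<k zero)) Q<k
    where
    mQ = proj₁ (Equivalence.to (proj₂ E⁻ Q) Q∈)
    Q<k = proj₂ (Equivalence.to (proj₂ E⁻ Q) Q∈)

  ⇒∈L⁻ : ∀ {Q} → InM V Q → w Q ℚ.< ℕ→ℚ k → Q ∈ L⁻
  ⇒∈L⁻ {Q} mQ wQ<k = Equivalence.from (proj₂ E⁻ Q) (mQ , λ i → ℚP.≤-<-trans (w-ub Q i) wQ<k)

  W⁺ : IsW V (suc c) (length L⁺) L⁺
  W⁺ = (proj₁ E⁺ , All.tabulate (proj₁ ∘ ∈L⁺⇒)) , refl , λ Q Q' Q∈ mQ' Q'∉ →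
    ℚP.<⇒≤ (ℚP.≤-<-trans (proj₂ (∈L⁺⇒ Q∈)) (ℚP.≰⇒> (Q'∉ ∘ ⇒∈L⁺ mQ')))

  W⁻ : IsW V (suc c) (length L⁻) L⁻
  W⁻ = (proj₁ E⁻ , All.tabulate (proj₁ ∘ ∈L⁻⇒)) , refl , λ Q Q' Q∈ mQ' Q'∉ →
    ℚP.<⇒≤ (ℚP.<-≤-trans (proj₂ (∈L⁻⇒ Q∈)) (ℚP.≮⇒≥ (Q'∉ ∘ ⇒∈L⁻ mQ')))

  fits-L⁺ : ∀ {S} → IsSubsetM V S → All (λ Q → w Q ℚ.≤ ℕ→ℚ k) S → length S ≤ length L⁺
  fits-L⁺ (uS , mS) S≤k = Unique⇒length≤ uS (All.zipWith (λ (mQ , wQ≤k) → ⇒∈L⁺ mQ wQ≤k) (mS , S≤k))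

  fits-L⁻ : ∀ {S} → IsSubsetM V S → All (λ Q → w Q ℚ.< ℕ→ℚ k) S → length S ≤ length L⁻
  fits-L⁻ (uS , mS) S<k = Unique⇒length≤ uS (All.zipWith (λ (mQ , wQ<k) → ⇒∈L⁻ mQ wQ<k) (mS , S<k))

  e₁-multiple : ℕ → Vec ℚ (suc n')
  e₁-multiple m = ℕ→ℚ m ∷ Vec.replicate n' ℚ.0ℚ

  e₁-multiple-∈M : ∀ m → InM V (e₁-multiple m)
  e₁-multiple-∈M m = nonNeg , integral
    where
    nonNeg : ∀ i → ℚ.0ℚ ℚ.≤ lookup (e₁-multiple m) i
    nonNeg zero    = 0≤ℕ→ℚ m
    nonNeg (suc i) = ℚP.≤-reflexive (sym (VecP.lookup-replicate i ℚ.0ℚ))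
    integral : ∀ j → IsInt (combCoord V (e₁-multiple m) j)
    integral j = + m ℤ.* v zero , (begin
      ℕ→ℚ m ℚ.* ℤ→ℚ (v zero) ℚ.+ ΣℚFin n' (λ i → lookup (Vec.replicate n' ℚ.0ℚ) i ℚ.* ℤ→ℚ (v (suc i)))
        ≡⟨ cong (ℕ→ℚ m ℚ.* ℤ→ℚ (v zero) ℚ.+_) (ΣℚFin-zeros n' _ λ i →
             trans (cong (ℚ._* ℤ→ℚ (v (suc i))) (VecP.lookup-replicate i ℚ.0ℚ)) (ℚP.*-zeroˡ (ℤ→ℚ (v (suc i))))) ⟩
      ℕ→ℚ m ℚ.* ℤ→ℚ (v zero) ℚ.+ ℚ.0ℚ
        ≡⟨ ℚP.+-identityʳ (ℕ→ℚ m ℚ.* ℤ→ℚ (v zero)) ⟩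
      ℕ→ℚ m ℚ.* ℤ→ℚ (v zero)
        ≡⟨ ℤ→ℚ-* (+ m) (v zero) ⟨
      ℤ→ℚ (+ m ℤ.* v zero) ∎)
      where
      open ≡-Reasoning
      v : Fin (suc n') → ℤ
      v i = lookup (lookup V i) j

  w-e₁-multiple : ∀ m → w (e₁-multiple m) ≡ ℕ→ℚ m
  w-e₁-multiple m = ℚP.≤-antisym (w-lub (e₁-multiple m) (0≤ℕ→ℚ m) ≤m) (w-ub (e₁-multiple m) zero)
    where
    ≤m : ∀ i → lookup (e₁-multiple m) i ℚ.≤ ℕ→ℚ m
    ≤m zero    = ℚP.≤-refl
    ≤m (suc i) = subst (ℚ._≤ ℕ→ℚ m) (sym (VecP.lookup-replicate i ℚ.0ℚ)) (0≤ℕ→ℚ m)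

  |L⁻|<|L⁺| : length L⁻ < length L⁺
  |L⁻|<|L⁺| = Unique⇒length≤ (All.tabulate ke₁≢ ∷ proj₁ E⁻) (ke₁∈L⁺ ∷ All.tabulate L⁻⊆L⁺)
    where
    ke₁∈L⁺ = ⇒∈L⁺ (e₁-multiple-∈M k) (ℚP.≤-reflexive (w-e₁-multiple k))
    ke₁≢ : ∀ {Q} → Q ∈ L⁻ → e₁-multiple k ≢ Q
    ke₁≢ Q∈ refl = ℚP.<-irrefl (w-e₁-multiple k) (proj₂ (∈L⁻⇒ Q∈))
    L⁻⊆L⁺ : ∀ {Q} → Q ∈ L⁻ → Q ∈ L⁺
    L⁻⊆L⁺ Q∈ = ⇒∈L⁺ (proj₁ (∈L⁻⇒ Q∈)) (ℚP.<⇒≤ (proj₂ (∈L⁻⇒ Q∈)))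

  1≤|L⁺| : 1 ≤ length L⁺
  1≤|L⁺| = ℕP.<-≤-trans (s≤s z≤n) |L⁻|<|L⁺|

  1≤|L⁻| : 1 ≤ k → 1 ≤ length L⁻
  1≤|L⁻| (s≤s {n = k'} _) = ∈-length (⇒∈L⁻ (e₁-multiple-∈M k')
    (subst (ℚ._< ℕ→ℚ k) (sym (w-e₁-multiple k')) (ℕ→ℚ-mono-< (ℕP.n<1+n k'))))

  increment-below : ∀ {m ya yb} → m < length L⁻ → HW V (suc c) m ya → HW V (suc c) (suc m) yb →
                    yb ℤ.- ya ℤ.< K
  increment-below m<|L⁻| ha hb = subst (ℤ._< K) (sym (HW-step WS ha hb)) (hpt-< q k (proj₁ q∈) (proj₂ q∈))
    where
    W-in-L⁻ = W-down W⁻ (ℕP.≤⇒≤′ m<|L⁻|)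
    WS = proj₁ (proj₂ W-in-L⁻)
    open Peeled (peel WS) renaming (top to q)
    q∈ = ∈L⁻⇒ (All.lookup (proj₂ (proj₂ W-in-L⁻)) top∈S)

  increment-between : ∀ {m ya yb} → length L⁻ ≤ m → m < length L⁺ →
                      HW V (suc c) m ya → HW V (suc c) (suc m) yb → yb ℤ.- ya ≡ K
  increment-between |L⁻|≤m m<|L⁺| ha hb =
    trans (HW-step WS ha hb) (hpt-≡ q k (proj₁ q∈) (ℚP.≤-antisym (proj₂ q∈) (ℚP.≮⇒≥ wq≮k)))
    where
    W-in-L⁺ = W-down W⁺ (ℕP.≤⇒≤′ m<|L⁺|)
    WS = proj₁ (proj₂ W-in-L⁺)
    open Peeled (peel WS) renaming (top to q)
    q∈ = ∈L⁺⇒ (All.lookup (proj₂ (proj₂ W-in-L⁺)) top∈S)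
    wq≮k : ¬ (w q ℚ.< ℕ→ℚ k)
    wq≮k wq<k = ℕP.<⇒≱ (subst (_≤ length L⁻) (proj₁ (proj₂ WS))
      (fits-L⁻ (proj₁ WS) (All.map (λ wQ≤wq → ℚP.≤-<-trans wQ≤wq wq<k) heaviest))) |L⁻|≤m

  increment-above : ∀ {m ya yb} → length L⁺ ≤ m → HW V (suc c) m ya → HW V (suc c) (suc m) yb →
                    K ℤ.< yb ℤ.- ya
  increment-above |L⁺|≤m ha hb@(S , WS , _) =
    subst (K ℤ.<_) (sym (HW-step WS ha hb)) (hpt-> q k (All.lookup (proj₂ (proj₁ WS)) top∈S) (ℚP.≰⇒> wq≰k))
    where
    open Peeled (peel WS) renaming (top to q)
    wq≰k : ¬ (w q ℚ.≤ ℕ→ℚ k)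
    wq≰k wq≤k = ℕP.<⇒≱ (subst (_≤ length L⁺) (proj₁ (proj₂ WS))
      (fits-L⁺ (proj₁ WS) (All.map (λ wQ≤wq → ℚP.≤-trans wQ≤wq wq≤k) heaviest))) |L⁺|≤m

  minimal-at-Δ⁺ : MinProp V (suc c) L⁺
  minimal-at-Δ⁺ = IHPval-of-pos 1≤|L⁺| (L⁺ , W⁺ , refl) , λ S subS |S| → W-minimal _ W⁺ subS |S|

  minimal-at-Δ⁻ : MinProp V (suc c) L⁻
  minimal-at-Δ⁻ = IHPval-of-below |L⁻|<|L⁺| (L⁻ , W⁻ , refl) (L⁺ , W⁺ , refl) ,
    λ S subS |S| → W-minimal _ W⁻ subS |S|

  slope-below : ∀ m → m < length L⁻ → SlopeAt V (suc c) m (λ s → s ℚ.< ℕ→ℚ (k * c))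
  slope-below m m<|L⁻| = SlopeAt-of-increments _ (ℚ._<? ℕ→ℚ (k * c)) λ h₀ h₁ →
    ℤ→ℚ-mono-< (increment-below m<|L⁻| h₀ h₁)

  slope-above : ∀ m → length L⁺ ≤ m → SlopeAt V (suc c) m (λ s → ℕ→ℚ (k * c) ℚ.< s)
  slope-above m |L⁺|≤m = SlopeAt-of-increments _ (ℕ→ℚ (k * c) ℚ.<?_) λ h₀ h₁ →
    ℤ→ℚ-mono-< (increment-above |L⁺|≤m h₀ h₁)

  slope-between : ∀ m → length L⁻ ≤ m → m < length L⁺ → SlopeAt V (suc c) m (λ s → s ≡ ℕ→ℚ (k * c))
  slope-between m |L⁻|≤m m<|L⁺| = SlopeAt-of-increments _ (ℚ._≟ ℕ→ℚ (k * c)) λ h₀ h₁ →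
    cong ℤ→ℚ (increment-between |L⁻|≤m m<|L⁺| h₀ h₁)

  vertex-Δ⁺ : IsVertex V (suc c) (length L⁺) (h (suc c) L⁺)
  vertex-Δ⁺ = IsVertex-of-kink 1≤|L⁺| hL⁺ λ {m} m+1≡ h₀ h₁ →
    subst (ℤ._< _) (sym (increment-between (ℕP.≤-pred (subst (length L⁻ <_) (sym m+1≡) |L⁻|<|L⁺|))
                                            (subst (m <_) m+1≡ (ℕP.n<1+n m)) h₀
                                            (subst (λ i → HW V (suc c) i (h (suc c) L⁺)) (sym m+1≡) hL⁺)))
      (increment-above ℕP.≤-refl hL⁺ h₁)
    where
    hL⁺ = L⁺ , W⁺ , refl

  vertex-Δ⁻ : 1 ≤ k → IsVertex V (suc c) (length L⁻) (h (suc c) L⁻)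
  vertex-Δ⁻ 1≤k = IsVertex-of-kink (1≤|L⁻| 1≤k) hL⁻ λ {m} m+1≡ h₀ h₁ →
    subst (_ ℤ.<_) (sym (increment-between ℕP.≤-refl |L⁻|<|L⁺| hL⁻ h₁))
      (increment-below (subst (m <_) m+1≡ (ℕP.n<1+n m)) h₀
                       (subst (λ i → HW V (suc c) i (h (suc c) L⁻)) (sym m+1≡) hL⁻))
    where
    hL⁻ = L⁻ , W⁻ , refl

corollary3p13 : (n : ℕ) → 1 ≤ n → (V : Vec (Vec ℤ n) n) → LinIndep V
    → (p : ℕ) → Prime p → ¬ (p ∣ Vol V)
    → (D : ℕ) → IsD V D → (n + 4) * D < p
    → (k : ℕ)
    → (L⁺ : List (Vec ℚ n)) → Enumerates V (InΔ⁺ V k) L⁺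
    → (L⁻ : List (Vec ℚ n)) → Enumerates V (InΔ⁻ V k) L⁻
    → (MinProp V p L⁺ × MinProp V p L⁻)
      × (∀ m → m < length L⁻ → SlopeAt V p m (λ s → s ℚ.< ℕ→ℚ (k * (p ∸ 1))))
      × (∀ m → length L⁺ ≤ m → SlopeAt V p m (λ s → ℕ→ℚ (k * (p ∸ 1)) ℚ.< s))
      × (∀ m → length L⁻ ≤ m → m < length L⁺ → SlopeAt V p m (λ s → s ≡ ℕ→ℚ (k * (p ∸ 1))))
      × (1 ≤ k → IsVertex V p (length L⁺) (h p L⁺) × IsVertex V p (length L⁻) (h p L⁻))
corollary3p13 zero ()
corollary3p13 (suc n') _ _ _ zero    _ _ _ _   ()
corollary3p13 (suc n') _ V _ (suc c) _ _ D isD [n+4]D<p k L⁺ E⁺ L⁻ E⁻ =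
  (minimal-at-Δ⁺ , minimal-at-Δ⁻) , slope-below , slope-above , slope-between ,
  λ 1≤k → vertex-Δ⁺ , vertex-Δ⁻ 1≤k
  where
  D≤c : D ≤ c
  D≤c = ℕP.≤-pred (ℕP.≤-<-trans (ℕP.m≤n*m D (suc n' + 4)) [n+4]D<p)
  open Corollary V isD c D≤c k E⁺ E⁻
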